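{- Let $m\ge1$ be an integer. When tiling with $(\frac12,\frac12;m+1)$-combs and $(\frac12,\frac12;m+2)$-combs, every mixed metatile has length at least $2m+3$, and the smallest mixed metatiles are exactly two, namely those whose combs, listed in order of the left ends of their first teeth, are $C,c,C,c$ and $c,C,C,c$ respectively (where $c$ denotes a $(\frac12,\frac12;m+1)$-comb and $C$ a $(\frac12,\frac12;m+2)$-comb); both have length $2m+3$.
   Context: For a positive integer $k$, a $(\frac12,\frac12;k)$-comb is a tile consisting of $k$ teeth of size $\frac12\times1$ in a row separated by $k-1$ gaps of width $\frac12$. An $n$-board is a $1\times n$ strip of $n$ unit cells, each divided into a left and a right slot of width $\frac12$. A tiling places combs so that each tooth occupies exactly one slot and every slot is occupied by exactly one tooth (gaps may contain teeth of other combs). A tile straddles the boundary between cells $i$ and $i+1$ if the interval from the left end of its first tooth to the right end of its last tooth contains that boundary in its interior. A metatile of length $l$ is a tiling of an $l$-board in which every internal cell boundary is straddled by some tile. A mixed metatile is a metatile containing combs of both types. -}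

module Defs where

open import Data.Nat using (ℕ; zero; suc; _+_; _*_; _≤_; _<_)
open import Data.Product using (_×_; _,_; proj₁; proj₂)
open import Data.List using (List; []; _∷_; map; upTo; concatMap)
open import Data.List.Relation.Unary.All using (All)
open import Data.List.Relation.Unary.Any using (Any)
open import Data.List.Relation.Unary.Linked using (Linked)
open import Data.List.Relation.Binary.Permutation.Propositional using (_↭_)
open import Data.Sum using (_⊎_)
open import Relation.Binary.PropositionalEquality using (_≡_)

-- Slots of an n-board are numbered 0 .. 2n-1 from left to right
-- (cell i, 0-based, has left slot 2i and right slot 2i+1).
-- A (1/2,1/2;k)-comb is determined by the slot s of its first tooth and
-- its number of teeth k; its teeth occupy slots s, s+2, ..., s+2(k-1).
Comb : Set
Comb = ℕ × ℕ

start : Comb → ℕ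
start = proj₁

size : Comb → ℕ
size = proj₂

teeth : Comb → List ℕ
teeth (s , k) = map (λ j → s + 2 * j) (upTo k)

-- A placement of combs is a list of combs listed in strictly increasing
-- order of the left ends of their first teeth (a canonical enumeration of
-- the set of tiles).
IsTiling : ℕ → List Comb → Set
IsTiling n T = Linked _<_ (map start T) × (concatMap teeth T ↭ upTo (2 * n))

UsesCombs : ℕ → List Comb → Set
UsesCombs m T = All (λ c → size c ≡ suc m ⊎ size c ≡ suc (suc m)) T

-- Comb (s,k) spans the real interval [s/2, (s+2k-1)/2]; it straddles the
-- boundary at position i (between cells i and i+1, 1-based) iff
-- s/2 < i < (s+2k-1)/2, i.e. s < 2i and 2i+1 < s+2k.
Straddles : ℕ → Comb → Set
Straddles i (s , k) = (s < 2 * i) × (2 * i + 1 < s + 2 * k)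

Metatile : ℕ → ℕ → List Comb → Set
Metatile m l T =
  UsesCombs m T × IsTiling l T ×
  (∀ i → 1 ≤ i → i < l → Any (Straddles i) T)

Mixed : ℕ → List Comb → Set
Mixed m T = Any (λ c → size c ≡ suc m) T × Any (λ c → size c ≡ suc (suc m)) T

MixedMetatile : ℕ → ℕ → List Comb → Set
MixedMetatile m l T = Metatile m l T × Mixed m T

-- The teeth of a comb all lie in slots of one parity, and a slot right after the last
-- tooth of a comb is the first tooth of the next one; so each parity class of slots is
-- filled, from slot 0 resp. 1, by a chain of consecutive combs.  If the combs at slots 0
-- and 1 had the same size a, boundary a would be straddled by neither of them (nor by
-- any later comb), unless a = n, when they would be the whole (unmixed) tiling.  So one
-- chain starts with a short comb (m + 1 teeth) and the other with a long one (m + 2),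
-- and continuing both chains by one comb gives n ≥ (m + 2) + (m + 1).  For n = 2m + 3
-- the long chain must continue with a short comb, and the short chain with a long one,
-- since two short combs would leave room for a third that cannot fit when m ≥ 1; thus
-- each parity class holds exactly two combs, and sorting them gives CcCc or cCCc.

module Submission where

open import Defs
open import Data.Nat
  using (ℕ; zero; suc; _+_; _*_; _≤_; _<_; z≤n; s≤s; z<s; s<s⁻¹; s≤s⁻¹; _<?_; _≤?_)
open import Data.Nat.Properties
open import Data.Nat.DivMod using (_%_; _/_; m%n<n; m≡m%n+[m/n]*n)
open import Data.Nat.Tactic.RingSolver using (solve-∀)
open import Data.Product using (Σ; _×_; _,_; proj₁; proj₂; uncurry; ∃-syntax; ∃₂)
open import Data.Sum as Sum using (_⊎_; inj₁; inj₂)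
open import Data.List using (List; []; _∷_; _++_; _∷ʳ_; map; upTo; concatMap)
open import Data.List.Properties using (++-assoc; ++-identityʳ; map-++; upTo-∷ʳ)
open import Data.List.Relation.Unary.All as All using (All; []; _∷_)
import Data.List.Relation.Unary.All.Properties as All
open import Data.List.Relation.Unary.Any using (Any; here; there)
open import Data.List.Relation.Unary.AllPairs using (AllPairs; []; _∷_)
import Data.List.Relation.Unary.AllPairs.Properties as AllPairs
open import Data.List.Relation.Unary.Linked using (Linked; []; [-]; _∷_)
open import Data.List.Relation.Unary.Linked.Properties using (Linked⇒AllPairs)
open import Data.List.Relation.Unary.Unique.Propositional using (Unique)
open import Data.List.Relation.Unary.Unique.Propositional.Properties using (upTo⁺)
open import Data.List.Membership.Propositional using (_∈_; _∉_; find; lose)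
open import Data.List.Membership.Propositional.Properties
  using (∈-upTo⁺; ∈-upTo⁻; ∈-map⁺; ∈-map⁻; ∈-concatMap⁺; ∈-concatMap⁻)
open import Data.List.Relation.Binary.Subset.Propositional using (_⊆_)
open import Data.List.Relation.Binary.Permutation.Propositional
  using (_↭_; ↭-refl; ↭-sym; ↭-trans; ↭-swap; ↭⇒↭ₛ; module PermutationReasoning)
open import Data.List.Relation.Binary.Permutation.Propositional.Properties
  using (∈-resp-↭; Any-resp-↭; ++⁺ˡ; ++⁺ʳ; ++-comm; shifts)
import Data.List.Relation.Binary.Permutation.Setoid.Properties as Setoid↭
open import Data.Empty using (⊥; ⊥-elim)
open import Function using (_∘_; _on_)
open import Relation.Nullary using (yes; no; contradiction)
open import Relation.Binary.PropositionalEquality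

-- Slot 2 * i + p, with p < 2, is the i-th slot of parity p.

private variable
  a b i j k k′ l n p q r s s′ x y : ℕ

0<2 : 0 < 2
0<2 = s≤s z≤n

1<2 : 1 < 2
1<2 = s≤s (s≤s z≤n)

half-< : 2 * x + p < 2 * y → x < y
half-< {x} {p} {y} lt = *-cancelˡ-< 2 x y (≤-<-trans (m≤m+n (2 * x) p) lt)

double-< : p < 2 → x < y → 2 * x + p < 2 * y
double-< {p} {x} {y} p<2 x<y = begin-strict
  2 * x + p    <⟨ +-monoʳ-< (2 * x) p<2 ⟩
  2 * x + 2    ≡⟨ +-comm (2 * x) 2 ⟩
  2 + 2 * x    ≡⟨ *-suc 2 x ⟨
  2 * suc x    ≤⟨ *-monoʳ-≤ 2 x<y ⟩
  2 * y        ∎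
  where open ≤-Reasoning

parity-split : ∀ s → ∃₂ λ p i → p < 2 × s ≡ 2 * i + p
parity-split s = s % 2 , s / 2 , m%n<n s 2 , (begin
  s                    ≡⟨ m≡m%n+[m/n]*n s 2 ⟩
  s % 2 + s / 2 * 2    ≡⟨ +-comm (s % 2) _ ⟩
  s / 2 * 2 + s % 2    ≡⟨ cong (_+ s % 2) (*-comm (s / 2) 2) ⟩
  2 * (s / 2) + s % 2  ∎)
  where open ≡-Reasoning

module _ {A : Set} where

  Unique-++⁻ʳ : ∀ (xs : List A) {ys} → Unique (xs ++ ys) → Unique ys
  Unique-++⁻ʳ []       u       = u
  Unique-++⁻ʳ (_ ∷ xs) (_ ∷ u) = Unique-++⁻ʳ xs u

  Unique-++⇒disjoint : ∀ (xs : List A) {ys z} → Unique (xs ++ ys) → z ∈ xs → z ∉ ys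
  Unique-++⇒disjoint (_ ∷ xs) (z≢ ∷ _) (here refl) z∈ys =
    All.lookup (All.++⁻ʳ xs z≢) z∈ys refl
  Unique-++⇒disjoint (_ ∷ xs) (_ ∷ u)  (there z∈)  = Unique-++⇒disjoint xs u z∈

  module _ {B : Set} (f : B → List A) where

    Unique-concatMap⇒disjoint : ∀ {bs b b′ z} → Unique (concatMap f bs) →
      b ∈ bs → b′ ∈ bs → z ∈ f b → z ∈ f b′ → b ≡ b′
    Unique-concatMap⇒disjoint         u (here refl) (here refl) _ _ = refl
    Unique-concatMap⇒disjoint {b ∷ _} u (here refl) (there b′∈) z∈ z∈′ =
      ⊥-elim (Unique-++⇒disjoint (f b) u z∈ (∈-concatMap⁺ f (lose b′∈ z∈′)))
    Unique-concatMap⇒disjoint {b ∷ _} u (there b∈) (here refl) z∈ z∈′ =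
      ⊥-elim (Unique-++⇒disjoint (f b) u z∈′ (∈-concatMap⁺ f (lose b∈ z∈)))
    Unique-concatMap⇒disjoint {b ∷ _} u (there b∈) (there b′∈) =
      Unique-concatMap⇒disjoint (Unique-++⁻ʳ (f b) u) b∈ b′∈

  module _ (key : A → ℕ) where

    private
      Sorted : List A → Set
      Sorted = AllPairs (_<_ on key)

      sorted : ∀ {xs} → Linked _<_ (map key xs) → Sorted xs
      sorted = AllPairs.map⁻ ∘ Linked⇒AllPairs <-trans

    sorted-⊆-antisym : ∀ {xs ys} → Linked _<_ (map key xs) → Linked _<_ (map key ys) →
      xs ⊆ ys → ys ⊆ xs → xs ≡ ys
    sorted-⊆-antisym lxs lys = go (sorted lxs) (sorted lys)
      where
      go : ∀ {xs ys} → Sorted xs → Sorted ys → xs ⊆ ys → ys ⊆ xs → xs ≡ ys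
      go [] [] _ _ = refl
      go [] (_ ∷ _) _ ys⊆xs with () ← ys⊆xs (here refl)
      go (_ ∷ _) [] xs⊆ys _ with () ← xs⊆ys (here refl)
      go {x ∷ xs} {y ∷ ys} (x< ∷ sxs) (y< ∷ sys) xs⊆ys ys⊆xs
        with xs⊆ys (here refl) | ys⊆xs (here refl)
      ... | there x∈ys | there y∈xs =
        ⊥-elim (<-asym (All.lookup y< x∈ys) (All.lookup x< y∈xs))
      ... | there x∈ys | here refl = ⊥-elim (<-irrefl refl (All.lookup y< x∈ys))
      ... | here refl | _ =
        cong (x ∷_) (go sxs sys (drop-head x< (xs⊆ys ∘ there)) (drop-head y< (ys⊆xs ∘ there)))
        where
        drop-head : ∀ {us vs} → All (λ u → key x < key u) us → us ⊆ x ∷ vs → us ⊆ vs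
        drop-head x<us us⊆ u∈ with us⊆ u∈
        ... | here refl = ⊥-elim (<-irrefl refl (All.lookup x<us u∈))
        ... | there u∈vs = u∈vs

slot-+ : ∀ i p j → 2 * i + p + 2 * j ≡ 2 * (i + j) + p
slot-+ = solve-∀

tooth-suc : ∀ s j → s + 2 * suc j ≡ 2 + (s + 2 * j)
tooth-suc = solve-∀

∈-teeth⁺ : j < k → s + 2 * j ∈ teeth (s , k)
∈-teeth⁺ {s = s} j<k = ∈-map⁺ (λ j → s + 2 * j) (∈-upTo⁺ j<k)

∈-teeth⁻ : x ∈ teeth (s , k) → ∃[ j ] j < k × x ≡ s + 2 * j
∈-teeth⁻ {s = s} x∈ with j , j∈ , refl ← ∈-map⁻ (λ j → s + 2 * j) x∈ =
  j , ∈-upTo⁻ j∈ , refl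

first-tooth : 0 < k → s ∈ teeth (s , k)
first-tooth {k = k} {s = s} 0<k = subst (_∈ teeth (s , k)) (+-identityʳ s) (∈-teeth⁺ {s = s} 0<k)

teeth-∷ʳ : ∀ s k → teeth (s , suc k) ≡ teeth (s , k) ∷ʳ (s + 2 * k)
teeth-∷ʳ s k = begin
  map f (upTo (suc k))     ≡⟨ cong (map f) (upTo-∷ʳ k) ⟨
  map f (upTo k ∷ʳ k)      ≡⟨ map-++ f (upTo k) (k ∷ []) ⟩
  map f (upTo k) ∷ʳ f k    ∎
  where
  open ≡-Reasoning
  f : ℕ → ℕ
  f j = s + 2 * j

teeth-++ : ∀ s a b → teeth (s , a) ++ teeth (2 * a + s , b) ≡ teeth (s , a + b)
teeth-++ s a zero = trans (++-identityʳ _) (cong (λ k → teeth (s , k)) (sym (+-identityʳ a)))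
teeth-++ s a (suc b) = begin
  teeth (s , a) ++ teeth (2 * a + s , suc b)
    ≡⟨ cong (teeth (s , a) ++_) (teeth-∷ʳ (2 * a + s) b) ⟩
  teeth (s , a) ++ (teeth (2 * a + s , b) ∷ʳ (2 * a + s + 2 * b))
    ≡⟨ ++-assoc (teeth (s , a)) _ _ ⟨
  (teeth (s , a) ++ teeth (2 * a + s , b)) ∷ʳ (2 * a + s + 2 * b)
    ≡⟨ cong₂ _∷ʳ_ (teeth-++ s a b) (trans (slot-+ a s b) (+-comm _ s)) ⟩
  teeth (s , a + b) ∷ʳ (s + 2 * (a + b))
    ≡⟨ teeth-∷ʳ s (a + b) ⟨
  teeth (s , suc (a + b))
    ≡⟨ cong (λ k → teeth (s , k)) (+-suc a b) ⟨
  teeth (s , a + suc b) ∎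
  where open ≡-Reasoning

upTo-∷ʳ² : ∀ k → upTo k ++ k ∷ suc k ∷ [] ≡ upTo (suc (suc k))
upTo-∷ʳ² k = begin
  upTo k ++ k ∷ suc k ∷ []      ≡⟨ ++-assoc (upTo k) (k ∷ []) (suc k ∷ []) ⟨
  (upTo k ∷ʳ k) ∷ʳ suc k        ≡⟨ cong (_∷ʳ suc k) (upTo-∷ʳ k) ⟩
  upTo (suc k) ∷ʳ suc k         ≡⟨ upTo-∷ʳ (suc k) ⟩
  upTo (suc (suc k))            ∎
  where open ≡-Reasoning

even-odd-teeth-↭ : ∀ n → teeth (0 , n) ++ teeth (1 , n) ↭ upTo (2 * n)
even-odd-teeth-↭ zero = ↭-refl
even-odd-teeth-↭ (suc n) = begin
  teeth (0 , suc n) ++ teeth (1 , suc n)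
    ≡⟨ cong₂ _++_ (teeth-∷ʳ 0 n) (teeth-∷ʳ 1 n) ⟩
  (evens ∷ʳ 2 * n) ++ (odds ∷ʳ suc (2 * n))
    ≡⟨ ++-assoc evens _ _ ⟩
  evens ++ 2 * n ∷ odds ++ suc (2 * n) ∷ []
    ↭⟨ ++⁺ˡ evens (shifts (2 * n ∷ []) odds) ⟩
  evens ++ odds ++ 2 * n ∷ suc (2 * n) ∷ []
    ≡⟨ ++-assoc evens odds _ ⟨
  (evens ++ odds) ++ 2 * n ∷ suc (2 * n) ∷ []
    ↭⟨ ++⁺ʳ _ (even-odd-teeth-↭ n) ⟩
  upTo (2 * n) ++ 2 * n ∷ suc (2 * n) ∷ []
    ≡⟨ upTo-∷ʳ² (2 * n) ⟩
  upTo (2 + 2 * n)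
    ≡⟨ cong upTo (*-suc 2 n) ⟨
  upTo (2 * suc n) ∎
  where
  open PermutationReasoning
  evens odds : List ℕ
  evens = teeth (0 , n)
  odds = teeth (1 , n)

module TilingProperties {n : ℕ} {T : List Comb}
  (tiles : concatMap teeth T ↭ upTo (2 * n))
  (positive-sizes : All (λ c → 0 < size c) T) where

  size-positive : (s , k) ∈ T → 0 < k
  size-positive = All.lookup positive-sizes

  tooth-on-board : ∀ {c} → c ∈ T → x ∈ teeth c → x < 2 * n
  tooth-on-board c∈ x∈ = ∈-upTo⁻ (∈-resp-↭ tiles (∈-concatMap⁺ teeth (lose c∈ x∈)))

  slot-covered : x < 2 * n → ∃[ c ] c ∈ T × x ∈ teeth c
  slot-covered x< = find (∈-concatMap⁻ teeth (∈-resp-↭ (↭-sym tiles) (∈-upTo⁺ x<)))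

  teeth-disjoint : ∀ {c d} → c ∈ T → d ∈ T → x ∈ teeth c → x ∈ teeth d → c ≡ d
  teeth-disjoint = Unique-concatMap⇒disjoint teeth
    (Setoid↭.Unique-resp-↭ (setoid ℕ) (↭⇒↭ₛ (↭-sym tiles)) (upTo⁺ (2 * n)))

  comb-fits : (2 * i + p , k) ∈ T → i + k ≤ n
  comb-fits {k = zero} c∈ with () ← size-positive c∈
  comb-fits {i} {p} {suc k} c∈ = subst (_≤ n) (sym (+-suc i k))
    (half-< (subst (_< 2 * n) (slot-+ i p k) (tooth-on-board c∈ (∈-teeth⁺ ≤-refl))))

  tooth-after-last-tooth-is-first : (s , suc k) ∈ T → (s′ , l) ∈ T → j < l →
    s′ + 2 * j ≡ s + 2 * suc k → j ≡ 0
  tooth-after-last-tooth-is-first {j = zero} _ _ _ _ = refl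
  tooth-after-last-tooth-is-first {s} {k} {s′} {l} {suc j} c∈ d∈ j<l eq
    with previous ← +-cancelˡ-≡ 2 (s′ + 2 * j) (s + 2 * k)
                      (trans (sym (tooth-suc s′ j)) (trans eq (tooth-suc s k)))
    with refl ← teeth-disjoint d∈ c∈ (∈-teeth⁺ {s = s′} (<-trans (n<1+n j) j<l))
                  (subst (_∈ teeth (s , suc k)) (sym previous) (∈-teeth⁺ ≤-refl))
    = ⊥-elim (<-irrefl (*-cancelˡ-≡ j k 2 (+-cancelˡ-≡ s _ _ previous)) (s<s⁻¹ j<l))

  next-comb : p < 2 → (2 * i + p , k) ∈ T → i + k < n → ∃[ k′ ] (2 * (i + k) + p , k′) ∈ T
  next-comb {k = zero} _ c∈ _ with () ← size-positive c∈
  next-comb {p} {i} {suc k} p<2 c∈ i+k<n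
    with (s , l) , d∈ , x∈ ← slot-covered (double-< p<2 i+k<n)
    with j , j<l , x≡ ← ∈-teeth⁻ x∈
    with refl ← tooth-after-last-tooth-is-first c∈ d∈ j<l
                  (trans (sym x≡) (sym (slot-+ i p (suc k))))
    = l , subst (λ s → (s , l) ∈ T) (trans (sym (+-identityʳ s)) (sym x≡)) d∈

  comb-at-tooth : (2 * i + p , k) ∈ T → (2 * (i + r) + p , k′) ∈ T → r < k → r ≡ 0 × k′ ≡ k
  comb-at-tooth {i} {p} {k} {r} c∈ d∈ r<k
    with same ← teeth-disjoint d∈ c∈ (first-tooth (size-positive d∈))
                  (subst (_∈ teeth (2 * i + p , k)) (slot-+ i p r) (∈-teeth⁺ {s = 2 * i + p} r<k))
    = +-cancelˡ-≡ i r 0 (trans (*-cancelˡ-≡ (i + r) i 2 (+-cancelʳ-≡ p _ _ (cong proj₁ same)))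
                               (sym (+-identityʳ i)))
    , cong proj₂ same

  start-on-board : (s , k) ∈ T → s < 2 * n
  start-on-board c∈ = tooth-on-board c∈ (first-tooth (size-positive c∈))

  comb-start : (s , k) ∈ T → ∃₂ λ p i → p < 2 × i < n × s ≡ 2 * i + p
  comb-start {s} c∈ with p , i , p<2 , refl ← parity-split s =
    p , i , p<2 , half-< (start-on-board c∈) , refl

  first-comb : p < 2 → 0 < n → ∃[ k ] (p , k) ∈ T
  first-comb {p} p<2 0<n with (s , k) , c∈ , p∈ ← slot-covered (double-< {x = 0} p<2 0<n)
                         with ∈-teeth⁻ p∈
  ... | zero , _ , p≡ =
    k , subst (λ s → (s , k) ∈ T) (trans (sym (+-identityʳ s)) (sym p≡)) c∈
  ... | suc j , _ , p≡ = ⊥-elim (m+n≮m 2 _ (subst (_< 2) (trans p≡ (tooth-suc s j)) p<2))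

  parity-class-of-two : (p , a) ∈ T → (2 * a + p , b) ∈ T → a + b ≡ n →
    (2 * i + p , k) ∈ T → i < n → (i ≡ 0 × k ≡ a) ⊎ (i ≡ a × k ≡ b)
  parity-class-of-two {a = a} {i = i} first second a+b≡n c∈ i<n with i <? a
  ... | yes i<a = inj₁ (comb-at-tooth {i = 0} first c∈ i<a)
  ... | no i≮a with r , refl ← m≤n⇒∃[o]m+o≡n (≮⇒≥ i≮a)
               with refl , refl ← comb-at-tooth {i = a} second c∈
                                    (+-cancelˡ-< a r _ (subst (a + r <_) (sym a+b≡n) i<n))
    = inj₂ (+-identityʳ a , refl)

complementary-parities : p < 2 → q < 2 → p ≢ q → (p ≡ 0 × q ≡ 1) ⊎ (p ≡ 1 × q ≡ 0)
complementary-parities {0} {0} _ _ 0≢0 = contradiction refl 0≢0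
complementary-parities {0} {1} _ _ _   = inj₁ (refl , refl)
complementary-parities {1} {0} _ _ _   = inj₂ (refl , refl)
complementary-parities {1} {1} _ _ 1≢1 = contradiction refl 1≢1
complementary-parities {suc (suc _)} (s≤s (s≤s ())) _ _
complementary-parities {q = suc (suc _)} _ (s≤s (s≤s ())) _

parity-cases : p < 2 → q < 2 → p ≢ q → r < 2 → r ≡ p ⊎ r ≡ q
parity-cases p<2 q<2 p≢q r<2
  with complementary-parities p<2 q<2 p≢q | n≤1⇒n≡0∨n≡1 (s≤s⁻¹ r<2)
... | inj₁ (refl , refl) | inj₁ refl = inj₁ refl
... | inj₁ (refl , refl) | inj₂ refl = inj₂ refl
... | inj₂ (refl , refl) | inj₁ refl = inj₂ refl
... | inj₂ (refl , refl) | inj₂ refl = inj₁ refl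

parity-classes-tile : p < 2 → q < 2 → p ≢ q → teeth (p , n) ++ teeth (q , n) ↭ upTo (2 * n)
parity-classes-tile {n = n} p<2 q<2 p≢q with complementary-parities p<2 q<2 p≢q
... | inj₁ (refl , refl) = even-odd-teeth-↭ n
... | inj₂ (refl , refl) = ↭-trans (++-comm (teeth (1 , n)) _) (even-odd-teeth-↭ n)

short+long : ∀ m → suc m + suc (suc m) ≡ 2 * m + 3
short+long = solve-∀

long+short : ∀ m → suc (suc m) + suc m ≡ 2 * m + 3
long+short = solve-∀

long+long : ∀ m → suc (suc m) + suc (suc m) ≡ 2 * m + 3 + 1
long+long = solve-∀

short+short<length : ∀ m → suc m + suc m < 2 * m + 3
short+short<length m = ≤-reflexive (identity m)
  where
  identity : ∀ m → suc (suc m + suc m) ≡ 2 * m + 3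
  identity = solve-∀

short+short+short : ∀ m → suc m + suc m + suc m ≡ 2 * m + 3 + m
short+short+short = solve-∀

twice-length : ∀ m → 2 * (2 * m + 3) ≡ 2 * suc m + 2 * suc (suc m)
twice-length = solve-∀

twoChains : ℕ → ℕ → ℕ → List Comb
twoChains m p q =
  (p , suc m) ∷ (q , suc (suc m)) ∷
  (2 * suc m + p , suc (suc m)) ∷ (2 * suc (suc m) + q , suc m) ∷ []

twoChains-tiles : ∀ m → p < 2 → q < 2 → p ≢ q →
  concatMap teeth (twoChains m p q) ↭ upTo (2 * (2 * m + 3))
twoChains-tiles {p} {q} m p<2 q<2 p≢q = begin
  S ++ L ++ S′ ++ L′ ++ []
    ≡⟨ cong (λ zs → S ++ L ++ S′ ++ zs) (++-identityʳ L′) ⟩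
  S ++ L ++ S′ ++ L′
    ↭⟨ ++⁺ˡ S (shifts L S′) ⟩
  S ++ S′ ++ L ++ L′
    ≡⟨ ++-assoc S S′ _ ⟨
  (S ++ S′) ++ L ++ L′
    ≡⟨ cong₂ _++_ (teeth-++ p (suc m) (suc (suc m))) (teeth-++ q (suc (suc m)) (suc m)) ⟩
  teeth (p , suc m + suc (suc m)) ++ teeth (q , suc (suc m) + suc m)
    ≡⟨ cong₂ (λ k l → teeth (p , k) ++ teeth (q , l)) (short+long m) (long+short m) ⟩
  teeth (p , 2 * m + 3) ++ teeth (q , 2 * m + 3)
    ↭⟨ parity-classes-tile {n = 2 * m + 3} p<2 q<2 p≢q ⟩
  upTo (2 * (2 * m + 3)) ∎
  where
  open PermutationReasoning
  S L S′ L′ : List ℕ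
  S = teeth (p , suc m)
  L = teeth (q , suc (suc m))
  S′ = teeth (2 * suc m + p , suc (suc m))
  L′ = teeth (2 * suc (suc m) + q , suc m)

twoChains-straddled : ∀ m → p < 2 → q < 2 → 1 ≤ i → i < 2 * m + 3 →
  Any (Straddles i) (twoChains m p q)
twoChains-straddled {p} {q} {i} m p<2 q<2 1≤i i<n with i ≤? suc m
... | yes i≤1+m = there (here (<-≤-trans q<2 (*-monoʳ-≤ 2 1≤i) , (begin-strict
  2 * i + 1                  <⟨ double-< 1<2 (s≤s i≤1+m) ⟩
  2 * suc (suc m)            ≤⟨ m≤n+m _ q ⟩
  q + 2 * suc (suc m)        ∎)))
  where open ≤-Reasoning
... | no i≰1+m = there (there (here (double-< p<2 (≰⇒> i≰1+m) , (begin-strict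
  2 * i + 1                        <⟨ double-< 1<2 i<n ⟩
  2 * (2 * m + 3)                  ≡⟨ twice-length m ⟩
  2 * suc m + 2 * suc (suc m)      ≤⟨ +-monoˡ-≤ (2 * suc (suc m)) (m≤m+n (2 * suc m) p) ⟩
  2 * suc m + p + 2 * suc (suc m)  ∎))))
  where open ≤-Reasoning

cCCc : ℕ → List Comb
cCCc m = twoChains m 0 1

CcCc : ℕ → List Comb
CcCc m = (0 , suc (suc m)) ∷ (1 , suc m) ∷
         (2 * suc m + 1 , suc (suc m)) ∷ (2 * suc (suc m) + 0 , suc m) ∷ []

CcCc↭twoChains : ∀ m → CcCc m ↭ twoChains m 1 0
CcCc↭twoChains m = ↭-swap _ _ ↭-refl

cCCc-sorted : ∀ m → Linked _<_ (map start (cCCc m))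
cCCc-sorted m = z<s
              ∷ <-≤-trans (double-< {x = 0} 1<2 z<s) (m≤m+n _ 0)
              ∷ <-≤-trans (double-< 0<2 (n<1+n (suc m))) (m≤m+n _ 1)
              ∷ [-]

CcCc-sorted : ∀ m → Linked _<_ (map start (CcCc m))
CcCc-sorted m = z<s
              ∷ <-≤-trans (double-< {x = 0} 1<2 z<s) (m≤m+n _ 1)
              ∷ <-≤-trans (double-< 1<2 (n<1+n (suc m))) (m≤m+n _ 0)
              ∷ [-]

cCCc-mixedMetatile : ∀ m → MixedMetatile m (2 * m + 3) (cCCc m)
cCCc-mixedMetatile m =
  ( (inj₁ refl ∷ inj₂ refl ∷ inj₂ refl ∷ inj₁ refl ∷ [])
  , (cCCc-sorted m , twoChains-tiles m 0<2 1<2 (λ ()))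
  , (λ _ → twoChains-straddled m 0<2 1<2) )
  , here refl , there (here refl)

CcCc-mixedMetatile : ∀ m → MixedMetatile m (2 * m + 3) (CcCc m)
CcCc-mixedMetatile m =
  ( (inj₂ refl ∷ inj₁ refl ∷ inj₂ refl ∷ inj₁ refl ∷ [])
  , (CcCc-sorted m , ↭-trans (shifts (teeth (0 , suc (suc m))) (teeth (1 , suc m)))
                             (twoChains-tiles m 1<2 0<2 (λ ())))
  , (λ _ 1≤i i<n → Any-resp-↭ (↭-sym (CcCc↭twoChains m))
                                (twoChains-straddled m 1<2 0<2 1≤i i<n)) )
  , there (here refl) , here refl

module MixedMetatileProperties {m n : ℕ} {T : List Comb} (1≤m : 1 ≤ m)
  (uses : UsesCombs m T)
  (tiles : concatMap teeth T ↭ upTo (2 * n))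
  (straddled : ∀ i → 1 ≤ i → i < n → Any (Straddles i) T)
  (mixed : Mixed m T) where

  size-cases : (s , k) ∈ T → k ≡ suc m ⊎ k ≡ suc (suc m)
  size-cases = All.lookup uses

  size-≥ : (s , k) ∈ T → suc m ≤ k
  size-≥ c∈ with size-cases c∈
  ... | inj₁ refl = ≤-refl
  ... | inj₂ refl = n≤1+n _

  open TilingProperties {n} tiles (All.tabulate (λ c∈ → <-≤-trans z<s (size-≥ c∈)))

  comb-fits-min : (2 * i + p , k) ∈ T → i + suc m ≤ n
  comb-fits-min {i} c∈ = ≤-trans (+-monoʳ-≤ i (size-≥ c∈)) (comb-fits c∈)

  board-nonempty : 0 < n
  board-nonempty with (_ , _) , c∈ , _ ← find (proj₁ mixed)
                 with _ , _ , _ , i<n , _ ← comb-start c∈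
    = ≤-<-trans z≤n i<n

  early-comb-is-first : (0 , a) ∈ T → (1 , a) ∈ T → (s , k) ∈ T → s < 2 * a →
    s ≤ 1 × k ≡ a
  early-comb-is-first A B c∈ s<2a with comb-start c∈
  ... | 0 , i , _ , _ , refl
    with refl , refl ← comb-at-tooth {i = 0} {r = i} A c∈ (half-< s<2a) = z≤n , refl
  ... | 1 , i , _ , _ , refl
    with refl , refl ← comb-at-tooth {i = 0} {r = i} B c∈ (half-< s<2a) = ≤-refl , refl
  ... | suc (suc _) , _ , s≤s (s≤s ()) , _

  first-sizes-differ : (0 , a) ∈ T → (1 , a) ∈ T → ⊥
  first-sizes-differ {a} A B with m≤n⇒m<n∨m≡n (comb-fits {i = 0} {p = 0} A)
  ... | inj₁ a<n
    with (s , _) , c∈ , s<2a , straddling ← find (straddled a (size-positive A) a<n)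
    with s≤1 , refl ← early-comb-is-first A B c∈ s<2a
    = <⇒≱ straddling (begin
        s + 2 * a   ≤⟨ +-monoˡ-≤ (2 * a) s≤1 ⟩
        1 + 2 * a   ≡⟨ +-comm 1 (2 * a) ⟩
        2 * a + 1   ∎)
    where open ≤-Reasoning
  ... | inj₂ refl
    with (_ , _) , short∈ , refl ← find (proj₁ mixed)
    with (_ , _) , long∈ , refl ← find (proj₂ mixed)
    with _ , short≡a ← early-comb-is-first A B short∈ (start-on-board short∈)
    with _ , long≡a ← early-comb-is-first A B long∈ (start-on-board long∈)
    = <-irrefl (trans short≡a (sym long≡a)) (n<1+n _)

  first-combs :
    ((0 , suc m) ∈ T × (1 , suc (suc m)) ∈ T) ⊎ ((1 , suc m) ∈ T × (0 , suc (suc m)) ∈ T)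
  first-combs with first-comb 0<2 board-nonempty | first-comb 1<2 board-nonempty
  ... | _ , A | _ , B with size-cases A | size-cases B
  ... | inj₁ refl | inj₁ refl = ⊥-elim (first-sizes-differ A B)
  ... | inj₁ refl | inj₂ refl = inj₁ (A , B)
  ... | inj₂ refl | inj₁ refl = inj₂ (B , A)
  ... | inj₂ refl | inj₂ refl = ⊥-elim (first-sizes-differ A B)

  short-successor : p < 2 → (p , suc m) ∈ T → (q , suc (suc m)) ∈ T →
    ∃[ c ] (2 * suc m + p , c) ∈ T
  short-successor {p} {q} p<2 S L = next-comb {p = p} {i = 0} p<2 S (comb-fits {i = 0} {p = q} L)

  long-successor : p < 2 → q < 2 → (p , suc m) ∈ T → (q , suc (suc m)) ∈ T →
    ∃[ d ] (2 * suc (suc m) + q , d) ∈ T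
  long-successor {p} {q} p<2 q<2 S L = next-comb {p = q} {i = 0} q<2 L
    (≤-trans (s≤s (+-monoˡ-≤ (suc m) 1≤m))
             (comb-fits-min {i = suc m} {p = p} (proj₂ (short-successor {q = q} p<2 S L))))

  short-long-bound : p < 2 → q < 2 → (p , suc m) ∈ T → (q , suc (suc m)) ∈ T → 2 * m + 3 ≤ n
  short-long-bound {p} {q} p<2 q<2 S L = begin
    2 * m + 3            ≡⟨ long+short m ⟨
    suc (suc m) + suc m  ≤⟨ comb-fits-min {i = suc (suc m)} {p = q}
                              (proj₂ (long-successor p<2 q<2 S L)) ⟩
    n                    ∎
    where open ≤-Reasoning

  length-lower-bound : 2 * m + 3 ≤ n
  length-lower-bound =
    Sum.[ uncurry (short-long-bound 0<2 1<2) , uncurry (short-long-bound 1<2 0<2) ]′ first-combs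

  module _ (n≡ : n ≡ 2 * m + 3) where

    long-chain-ends-short : (2 * suc (suc m) + q , k) ∈ T → k ≡ suc m
    long-chain-ends-short {q} c∈ with size-cases c∈
    ... | inj₁ k≡ = k≡
    ... | inj₂ refl = ⊥-elim (m+1+n≰m (2 * m + 3) (begin
      2 * m + 3 + 1                ≡⟨ long+long m ⟨
      suc (suc m) + suc (suc m)    ≤⟨ comb-fits {i = suc (suc m)} {p = q} c∈ ⟩
      n                            ≡⟨ n≡ ⟩
      2 * m + 3                    ∎))
      where open ≤-Reasoning

    short-chain-ends-long : p < 2 → (2 * suc m + p , k) ∈ T → k ≡ suc (suc m)
    short-chain-ends-long {p} p<2 c∈ with size-cases c∈
    ... | inj₂ k≡ = k≡
    ... | inj₁ refl = ⊥-elim (m+1+n≰m (2 * m + 3) (begin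
      2 * m + 3 + 1                ≤⟨ +-monoʳ-≤ (2 * m + 3) 1≤m ⟩
      2 * m + 3 + m                ≡⟨ short+short+short m ⟨
      suc m + suc m + suc m        ≤⟨ comb-fits-min {i = suc m + suc m} {p = p} (proj₂ third) ⟩
      n                            ≡⟨ n≡ ⟩
      2 * m + 3                    ∎))
      where
      open ≤-Reasoning
      third : ∃[ k ] (2 * (suc m + suc m) + p , k) ∈ T
      third = next-comb {p = p} {i = suc m} p<2 c∈
                (≤-trans (short+short<length m) (≤-reflexive (sym n≡)))

    short-chain : p < 2 → (p , suc m) ∈ T → (q , suc (suc m)) ∈ T →
      (2 * suc m + p , suc (suc m)) ∈ T
    short-chain {p} {q} p<2 S L =
      let c , S′ = short-successor {q = q} p<2 S L
      in subst (λ c → (2 * suc m + p , c) ∈ T) (short-chain-ends-long p<2 S′) S′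

    long-chain : p < 2 → q < 2 → (p , suc m) ∈ T → (q , suc (suc m)) ∈ T →
      (2 * suc (suc m) + q , suc m) ∈ T
    long-chain {p} {q} p<2 q<2 S L =
      let d , L′ = long-successor p<2 q<2 S L
      in subst (λ d → (2 * suc (suc m) + q , d) ∈ T) (long-chain-ends-short L′) L′

    T⊆twoChains : p < 2 → q < 2 → p ≢ q → (p , suc m) ∈ T → (q , suc (suc m)) ∈ T →
      (2 * suc m + p , suc (suc m)) ∈ T → (2 * suc (suc m) + q , suc m) ∈ T →
      T ⊆ twoChains m p q
    T⊆twoChains {p} {q} p<2 q<2 p≢q S L S′ L′ {s , k} c∈ with comb-start c∈
    ... | r , i , r<2 , i<n , refl with parity-cases p<2 q<2 p≢q r<2
    ...   | inj₁ refl with parity-class-of-two {p = p} {a = suc m} {b = suc (suc m)}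
                             S S′ (trans (short+long m) (sym n≡)) c∈ i<n
    ...     | inj₁ (refl , refl) = here refl
    ...     | inj₂ (refl , refl) = there (there (here refl))
    T⊆twoChains {p} {q} p<2 q<2 p≢q S L S′ L′ {s , k} c∈ | r , i , r<2 , i<n , refl | inj₂ refl
      with parity-class-of-two {p = q} {a = suc (suc m)} {b = suc m}
             L L′ (trans (long+short m) (sym n≡)) c∈ i<n
    ...     | inj₁ (refl , refl) = there (here refl)
    ...     | inj₂ (refl , refl) = there (there (there (here refl)))

    T-is-twoChains : p < 2 → q < 2 → p ≢ q → (p , suc m) ∈ T → (q , suc (suc m)) ∈ T →
      T ⊆ twoChains m p q × twoChains m p q ⊆ T
    T-is-twoChains {p} {q} p<2 q<2 p≢q S L = T⊆twoChains p<2 q<2 p≢q S L S′ L′ , twoChains⊆T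
      where
      S′ : (2 * suc m + p , suc (suc m)) ∈ T
      S′ = short-chain {q = q} p<2 S L
      L′ : (2 * suc (suc m) + q , suc m) ∈ T
      L′ = long-chain p<2 q<2 S L
      twoChains⊆T : twoChains m p q ⊆ T
      twoChains⊆T (here refl)                         = S
      twoChains⊆T (there (here refl))                 = L
      twoChains⊆T (there (there (here refl)))         = S′
      twoChains⊆T (there (there (there (here refl)))) = L′

    smallest-mixed-metatiles : Linked _<_ (map start T) → T ≡ CcCc m ⊎ T ≡ cCCc m
    smallest-mixed-metatiles sorted = Sum.[ is-cCCc , is-CcCc ]′ first-combs
      where
      is-cCCc : (0 , suc m) ∈ T × (1 , suc (suc m)) ∈ T → T ≡ CcCc m ⊎ T ≡ cCCc m
      is-cCCc (S , L) = let T⊆ , ⊆T = T-is-twoChains 0<2 1<2 (λ ()) S L in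
        inj₂ (sorted-⊆-antisym start sorted (cCCc-sorted m) T⊆ ⊆T)
      is-CcCc : (1 , suc m) ∈ T × (0 , suc (suc m)) ∈ T → T ≡ CcCc m ⊎ T ≡ cCCc m
      is-CcCc (S , L) = let T⊆ , ⊆T = T-is-twoChains 1<2 0<2 (λ ()) S L in
        inj₁ (sorted-⊆-antisym start sorted (CcCc-sorted m)
                (∈-resp-↭ (↭-sym (CcCc↭twoChains m)) ∘ T⊆)
                (⊆T ∘ ∈-resp-↭ (CcCc↭twoChains m)))

corollary2 : ∀ (m : ℕ) → 1 ≤ m →
    ((l : ℕ) (T : List Comb) → MixedMetatile m l T → 2 * m + 3 ≤ l)
    × Σ (List Comb) (λ T₁ → Σ (List Comb) (λ T₂ →
        MixedMetatile m (2 * m + 3) T₁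
        × map size T₁ ≡ suc (suc m) ∷ suc m ∷ suc (suc m) ∷ suc m ∷ []
        × MixedMetatile m (2 * m + 3) T₂
        × map size T₂ ≡ suc m ∷ suc (suc m) ∷ suc (suc m) ∷ suc m ∷ []
        × ((T : List Comb) → MixedMetatile m (2 * m + 3) T → T ≡ T₁ ⊎ T ≡ T₂)))
corollary2 m 1≤m =
  (λ { _ _ ((uses , (_ , tiles) , straddled) , mixed) →
         MixedMetatileProperties.length-lower-bound 1≤m uses tiles straddled mixed })
  , CcCc m , cCCc m
  , CcCc-mixedMetatile m , refl
  , cCCc-mixedMetatile m , refl
  , λ { _ ((uses , (sorted , tiles) , straddled) , mixed) →
         MixedMetatileProperties.smallest-mixed-metatiles 1≤m uses tiles straddled mixed refl sorted }
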